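{- For any graph $G$ with $n$ vertices and $m$ edges, $\nabla(L(G))\geq m-n+1$.
   Context: $L(G)$ is the line graph of $G$ (vertices are the edges of $G$, adjacent iff they share an endpoint). For a graph $H$, $\nabla(H)$ (the decycling number) is the minimum number of vertices whose removal from $H$ leaves an acyclic graph. -}

module Defs where

open import Data.Nat using (ℕ; zero; suc; _+_; _≤_)
open import Data.Fin using (Fin; zero; suc; inject₁; fromℕ)
open import Data.Fin.Subset using (Subset; _∈_; _∉_; ∣_∣)
open import Data.Product using (Σ; _×_; _,_)
open import Data.Sum using (_⊎_)
open import Relation.Binary.PropositionalEquality using (_≡_; _≢_)
open import Relation.Nullary using (¬_)
open import Function.Definitions using (Injective)

-- Edge e joins  src e  and  tgt e  (orientation
-- is irrelevant); no loops, and no two distinct labels name the same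
-- unordered pair (no multiple edges).
record SimpleGraph (n m : ℕ) : Set where
  field
    src tgt  : Fin m → Fin n
    loopless : ∀ e → src e ≢ tgt e
    simple   : ∀ e e' →
               ((src e ≡ src e' × tgt e ≡ tgt e') ⊎ (src e ≡ tgt e' × tgt e ≡ src e'))
               → e ≡ e'
open SimpleGraph public

record Graph (k : ℕ) : Set₁ where
  field
    Adj : Fin k → Fin k → Set
open Graph public

LineGraph : ∀ {n m} → SimpleGraph n m → Graph m
Adj (LineGraph G) e e' =
  e ≢ e' ×
  (  src G e ≡ src G e' ⊎ src G e ≡ tgt G e'
   ⊎ tgt G e ≡ src G e' ⊎ tgt G e ≡ tgt G e')

-- A cycle of length l + 3 in H: distinct vertices v₀ … v_{l+2} with
-- consecutive ones adjacent and v_{l+2} adjacent to v₀.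
record Cycle {k : ℕ} (H : Graph k) (l : ℕ) : Set where
  field
    vtx      : Fin (3 + l) → Fin k
    distinct : Injective _≡_ _≡_ vtx
    step     : ∀ (i : Fin (2 + l)) → Adj H (vtx (inject₁ i)) (vtx (suc i))
    close    : Adj H (vtx (fromℕ (2 + l))) (vtx zero)
open Cycle public

Decycles : ∀ {k} → Graph k → Subset k → Set
Decycles H S = ∀ l (c : Cycle H l) → ¬ (∀ i → vtx c i ∉ S)

IsDecyclingNumber : ∀ {k} → Graph k → ℕ → Set
IsDecyclingNumber {k} H d =
  Σ (Subset k) (λ S → Decycles H S × ∣ S ∣ ≡ d)
  × (∀ (S : Subset k) → Decycles H S → d ≤ ∣ S ∣)

-- The edges outside a decycling set S of L(G) contain no cycle of G: the
-- edges of a cycle of G of length at least 3 are distinct and form a cycle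
-- of L(G) avoiding S.  So they form a forest on n vertices, which has fewer
-- than n edges, giving m − ∣S∣ ≤ n − 1.  The forest bound is proved by
-- deleting a leaf: an acyclic nonempty edge set has a vertex of degree at
-- most 1, since if every degree were at least 2, every path could be
-- prolonged at its end without closing a cycle, whereas paths have fewer
-- than n edges.
module Submission where

open import Defs
open import Data.Empty using (⊥; ⊥-elim)
open import Data.Fin using (Fin; zero; suc; toℕ; _≟_)
open import Data.Fin.Properties using (toℕ-injective; toℕ<n; toℕ≤pred[n]; toℕ-inject₁; toℕ-fromℕ; any?; pigeonhole)
open import Data.Fin.Subset
  using (Subset; inside; outside; _∈_; _∉_; _⊆_; _⊂_; _∩_; _─_; _-_; ∁; ⁅_⁆; ∣_∣; ⊤; Nonempty; Empty)
open import Data.Fin.Subset.Properties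
  using ( _∈?_; nonempty?; Empty-unique; ∣⊥∣≡0; ∣⊤∣≡n; ∈⊤; ∣⁅x⁆∣≡1; x∉⁅y⁆⇒x≢y
        ; ∣p∩q∣≤∣q∣; x∈p∩q⁻; p─q⊆p; x∈p∧x≢y⇒x∈p-y; x∈p⇒p-x⊂p; x∈p⇒∣p-x∣<∣p∣
        ; ∣∁p∣≡n∸∣p∣; x∈∁p⇒x∉p)
open import Data.Fin.Subset.Induction using (⊂-wellFounded; Acc; acc)
open import Data.Nat using (ℕ; zero; suc; _+_; _∸_; _≤_; _<_; z≤n; s≤s; z<s; _≤?_; _<?_)
open import Data.Nat.Properties hiding (_≟_)
open import Data.Product using (∃; _×_; _,_; proj₁; proj₂)
open import Data.Sum using (_⊎_; inj₁; inj₂)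
open import Data.Vec using ([]; _∷_; tabulate; here; there)
open import Data.Vec.Properties using (lookup∘tabulate; lookup⇒[]=; []=⇒lookup)
open import Function using (_∘_)
open import Level using (0ℓ)
open import Relation.Binary.PropositionalEquality
open import Relation.Nullary using (¬_; yes; no; does)
open import Relation.Nullary.Decidable using (_×-dec_; _⊎-dec_; dec-true)
open import Relation.Unary using (Pred; Decidable)

∣p∣≡∣p─q∣+∣p∩q∣ : ∀ {k} (p q : Subset k) → ∣ p ∣ ≡ ∣ p ─ q ∣ + ∣ p ∩ q ∣
∣p∣≡∣p─q∣+∣p∩q∣ []            []            = refl
∣p∣≡∣p─q∣+∣p∩q∣ (inside  ∷ p) (inside  ∷ q) =
  trans (cong suc (∣p∣≡∣p─q∣+∣p∩q∣ p q)) (sym (+-suc ∣ p ─ q ∣ ∣ p ∩ q ∣))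
∣p∣≡∣p─q∣+∣p∩q∣ (inside  ∷ p) (outside ∷ q) = cong suc (∣p∣≡∣p─q∣+∣p∩q∣ p q)
∣p∣≡∣p─q∣+∣p∩q∣ (outside ∷ p) (inside  ∷ q) = ∣p∣≡∣p─q∣+∣p∩q∣ p q
∣p∣≡∣p─q∣+∣p∩q∣ (outside ∷ p) (outside ∷ q) = ∣p∣≡∣p─q∣+∣p∩q∣ p q

x∈p─q⇒x∉q : ∀ {k} {x : Fin k} {p q : Subset k} → x ∈ p ─ q → x ∉ q
x∈p─q⇒x∉q {p = _ ∷ _} {inside ∷ _} ()        here
x∈p─q⇒x∉q {p = _ ∷ _} {_      ∷ _} (there x∈) (there y∈) = x∈p─q⇒x∉q x∈ y∈

Empty⇒∣p∣≡0 : ∀ {k} {p : Subset k} → Empty p → ∣ p ∣ ≡ 0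
Empty⇒∣p∣≡0 {k} empty rewrite Empty-unique empty = ∣⊥∣≡0 k

x∈p⇒0<∣p∣ : ∀ {k} {x : Fin k} {p : Subset k} → x ∈ p → 0 < ∣ p ∣
x∈p⇒0<∣p∣ x∈p = ≤-<-trans z≤n (x∈p⇒∣p-x∣<∣p∣ x∈p)

x∈p∧y∈p∧x≢y⇒2≤∣p∣ : ∀ {k} {x y : Fin k} {p : Subset k} → x ∈ p → y ∈ p → x ≢ y → 2 ≤ ∣ p ∣
x∈p∧y∈p∧x≢y⇒2≤∣p∣ x∈p y∈p x≢y =
  <-≤-trans (s≤s (x∈p⇒0<∣p∣ (x∈p∧x≢y⇒x∈p-y y∈p (x≢y ∘ sym)))) (x∈p⇒∣p-x∣<∣p∣ x∈p)

∣p∩q∣≤1⇒∣p∣≤1+∣p─q∣ : ∀ {k} (p q : Subset k) → ∣ p ∩ q ∣ ≤ 1 → ∣ p ∣ ≤ suc ∣ p ─ q ∣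
∣p∩q∣≤1⇒∣p∣≤1+∣p─q∣ p q ∣p∩q∣≤1 = begin
  ∣ p ∣                 ≡⟨ ∣p∣≡∣p─q∣+∣p∩q∣ p q ⟩
  ∣ p ─ q ∣ + ∣ p ∩ q ∣ ≤⟨ +-monoʳ-≤ ∣ p ─ q ∣ ∣p∩q∣≤1 ⟩
  ∣ p ─ q ∣ + 1         ≡⟨ +-comm ∣ p ─ q ∣ 1 ⟩
  suc ∣ p ─ q ∣         ∎
  where open ≤-Reasoning

∣p∣≤1+∣p-x∣ : ∀ {k} (p : Subset k) x → ∣ p ∣ ≤ suc ∣ p - x ∣
∣p∣≤1+∣p-x∣ p x =
  ∣p∩q∣≤1⇒∣p∣≤1+∣p─q∣ p ⁅ x ⁆ (≤-trans (∣p∩q∣≤∣q∣ p ⁅ x ⁆) (≤-reflexive (∣⁅x⁆∣≡1 x)))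

2≤∣p∣⇒∃≢ : ∀ {k} {p : Subset k} → 2 ≤ ∣ p ∣ → ∀ x → ∃ λ y → y ∈ p × y ≢ x
2≤∣p∣⇒∃≢ {p = p} 2≤∣p∣ x with nonempty? (p - x)
... | yes (y , y∈p-x) = y , p─q⊆p p ⁅ x ⁆ y∈p-x , x∉⁅y⁆⇒x≢y (x∈p─q⇒x∉q y∈p-x)
... | no  empty       = ⊥-elim (1+n≰n (begin
  2                 ≤⟨ 2≤∣p∣ ⟩
  ∣ p ∣             ≤⟨ ∣p∣≤1+∣p-x∣ p x ⟩
  suc ∣ p - x ∣     ≡⟨ cong suc (Empty⇒∣p∣≡0 empty) ⟩
  1                 ∎))
  where open ≤-Reasoning

subsetOf : ∀ {k} {P : Pred (Fin k) 0ℓ} → Decidable P → Subset k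
subsetOf P? = tabulate (does ∘ P?)

module _ {k} {P : Pred (Fin k) 0ℓ} (P? : Decidable P) where

  ∈subsetOf⁺ : ∀ {x} → P x → x ∈ subsetOf P?
  ∈subsetOf⁺ {x} px = lookup⇒[]= x _ (trans (lookup∘tabulate (does ∘ P?) x) (dec-true (P? x) px))

  ∈subsetOf⁻ : ∀ {x} → x ∈ subsetOf P? → P x
  ∈subsetOf⁻ {x} x∈ with P? x | trans (sym (lookup∘tabulate (does ∘ P?) x)) ([]=⇒lookup x∈)
  ... | yes px | _ = px
  ... | no _   | ()

infixr 5 _∷ˢ_

_∷ˢ_ : ∀ {A : Set} → A → (ℕ → A) → ℕ → A
(x ∷ˢ f) zero    = x
(x ∷ˢ f) (suc i) = f i

module _ {n m : ℕ} (G : SimpleGraph n m) where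

  Joins : Fin m → Fin n → Fin n → Set
  Joins e a b = (src G e ≡ a × tgt G e ≡ b) ⊎ (src G e ≡ b × tgt G e ≡ a)

  Incident : Fin n → Fin m → Set
  Incident v e = src G e ≡ v ⊎ tgt G e ≡ v

  incident? : ∀ v → Decidable (Incident v)
  incident? v e = src G e ≟ v ⊎-dec tgt G e ≟ v

  edgesAt : Fin n → Subset m
  edgesAt v = subsetOf (incident? v)

  ∈edgesAt⁺ : ∀ {v e} → Incident v e → e ∈ edgesAt v
  ∈edgesAt⁺ {v} = ∈subsetOf⁺ (incident? v)

  ∈edgesAt⁻ : ∀ {v e} → e ∈ edgesAt v → Incident v e
  ∈edgesAt⁻ {v} = ∈subsetOf⁻ (incident? v)

  EdgesWithin : Subset n → Subset m → Set
  EdgesWithin V E = ∀ {e} → e ∈ E → src G e ∈ V × tgt G e ∈ V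

  joins-sym : ∀ {e a b} → Joins e a b → Joins e b a
  joins-sym (inj₁ ends) = inj₂ ends
  joins-sym (inj₂ ends) = inj₁ ends

  joins-irrefl : ∀ {e a} → ¬ Joins e a a
  joins-irrefl {e} (inj₁ (p , q)) = loopless G e (trans p (sym q))
  joins-irrefl {e} (inj₂ (p , q)) = loopless G e (trans p (sym q))

  joins-unique : ∀ {e e' a b} → Joins e a b → Joins e' a b → e ≡ e'
  joins-unique {e} {e'} (inj₁ (p , q)) (inj₁ (p' , q')) = simple G e e' (inj₁ (trans p (sym p') , trans q (sym q')))
  joins-unique {e} {e'} (inj₁ (p , q)) (inj₂ (p' , q')) = simple G e e' (inj₂ (trans p (sym q') , trans q (sym p')))
  joins-unique {e} {e'} (inj₂ (p , q)) (inj₁ (p' , q')) = simple G e e' (inj₂ (trans p (sym q') , trans q (sym p')))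
  joins-unique {e} {e'} (inj₂ (p , q)) (inj₂ (p' , q')) = simple G e e' (inj₁ (trans p (sym p') , trans q (sym q')))

  joins-ends : ∀ {e a b c d} → Joins e a b → Joins e c d → (a ≡ c × b ≡ d) ⊎ (a ≡ d × b ≡ c)
  joins-ends (inj₁ (p , q)) (inj₁ (p' , q')) = inj₁ (trans (sym p) p' , trans (sym q) q')
  joins-ends (inj₁ (p , q)) (inj₂ (p' , q')) = inj₂ (trans (sym p) p' , trans (sym q) q')
  joins-ends (inj₂ (p , q)) (inj₁ (p' , q')) = inj₂ (trans (sym q) q' , trans (sym p) p')
  joins-ends (inj₂ (p , q)) (inj₂ (p' , q')) = inj₁ (trans (sym q) q' , trans (sym p) p')

  joins⇒adjacent : ∀ {e e' a b c} → Joins e a b → Joins e' b c → e ≢ e' → Adj (LineGraph G) e e'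
  joins⇒adjacent (inj₁ (_ , q)) (inj₁ (p' , _)) e≢e' = e≢e' , inj₂ (inj₂ (inj₁ (trans q (sym p'))))
  joins⇒adjacent (inj₁ (_ , q)) (inj₂ (_ , q')) e≢e' = e≢e' , inj₂ (inj₂ (inj₂ (trans q (sym q'))))
  joins⇒adjacent (inj₂ (p , _)) (inj₁ (p' , _)) e≢e' = e≢e' , inj₁ (trans p (sym p'))
  joins⇒adjacent (inj₂ (p , _)) (inj₂ (_ , q')) e≢e' = e≢e' , inj₂ (inj₁ (trans p (sym q')))

  joins⇒incident : ∀ {e a b} → Joins e a b → Incident a e
  joins⇒incident (inj₁ (p , _)) = inj₁ p
  joins⇒incident (inj₂ (_ , q)) = inj₂ q

  incident⇒joins : ∀ {v e} → Incident v e → ∃ (Joins e v)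
  incident⇒joins {e = e} (inj₁ p) = tgt G e , inj₁ (p , refl)
  incident⇒joins {e = e} (inj₂ q) = src G e , inj₂ (refl , q)

  incident-within : ∀ {V E e v} → EdgesWithin V E → e ∈ E → Incident v e → v ∈ V
  incident-within within e∈E (inj₁ refl) = proj₁ (within e∈E)
  incident-within within e∈E (inj₂ refl) = proj₂ (within e∈E)

  module _ (E : Subset m) where

    record Path (T : ℕ) : Set where
      field
        vertex           : ℕ → Fin n
        edge             : ℕ → Fin m
        vertex-injective : ∀ {i j} → i ≤ T → j ≤ T → vertex i ≡ vertex j → i ≡ j
        edge-joins       : ∀ {i} → i < T → Joins (edge i) (vertex i) (vertex (suc i))
        edge-∈           : ∀ {i} → i < T → edge i ∈ E

    record CycleIn (l : ℕ) : Set where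
      field
        vertex           : ℕ → Fin n
        edge             : ℕ → Fin m
        vertex-injective : ∀ {i j} → i ≤ 2 + l → j ≤ 2 + l → vertex i ≡ vertex j → i ≡ j
        closes           : vertex (3 + l) ≡ vertex 0
        edge-joins       : ∀ {i} → i ≤ 2 + l → Joins (edge i) (vertex i) (vertex (suc i))
        edge-∈           : ∀ {i} → i ≤ 2 + l → edge i ∈ E

  Acyclic : Subset m → Set
  Acyclic E = ∀ l → ¬ CycleIn E l

  module _ {E : Subset m} {l : ℕ} (c : CycleIn E l) where
    open CycleIn c

    private
      traversed-back-at-close : ∀ {i} → i ≤ 2 + l →
        vertex i ≡ vertex (3 + l) → vertex (suc i) ≡ vertex (2 + l) → ⊥
      traversed-back-at-close i≤ p q with vertex-injective i≤ z≤n (trans p closes)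
      ... | refl with vertex-injective (s≤s z≤n) ≤-refl q
      ... | ()

      traversed-back : ∀ {i j} → i ≤ 2 + l → j ≤ 2 + l →
        vertex i ≡ vertex (suc j) → vertex (suc i) ≡ vertex j → ⊥
      traversed-back i≤ j≤ p q with m≤n⇒m<n∨m≡n i≤ | m≤n⇒m<n∨m≡n j≤
      ... | _        | inj₂ refl = traversed-back-at-close i≤ p q
      ... | inj₂ refl | _        = traversed-back-at-close j≤ (sym q) (sym p)
      ... | inj₁ i<K | inj₁ j<K with vertex-injective (<⇒≤ i<K) j<K p
      ... | refl with vertex-injective i<K (<⇒≤ j<K) q
      ... | ()

    edge-injective : ∀ {i j} → i ≤ 2 + l → j ≤ 2 + l → edge i ≡ edge j → i ≡ j
    edge-injective i≤ j≤ eq with joins-ends (edge-joins i≤) (subst (λ e → Joins e _ _) (sym eq) (edge-joins j≤))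
    ... | inj₁ (p , _) = vertex-injective i≤ j≤ p
    ... | inj₂ (p , q) = ⊥-elim (traversed-back i≤ j≤ p q)

    edge-adjacent : ∀ {i} → suc i ≤ 2 + l → Adj (LineGraph G) (edge i) (edge (suc i))
    edge-adjacent {i} i<K = joins⇒adjacent (edge-joins (<⇒≤ i<K)) (edge-joins i<K)
      (λ eq → 1+n≰n (≤-reflexive (sym (edge-injective (<⇒≤ i<K) i<K eq))))

    closing-adjacent : Adj (LineGraph G) (edge (2 + l)) (edge 0)
    closing-adjacent = joins⇒adjacent (subst (Joins (edge (2 + l)) _) closes (edge-joins ≤-refl)) (edge-joins z≤n)
      (λ eq → 2+l≢0 (edge-injective ≤-refl z≤n eq))
      where 2+l≢0 : 2 + l ≢ 0
            2+l≢0 ()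

    lineCycle : Cycle (LineGraph G) l
    vtx      lineCycle i = edge (toℕ i)
    distinct lineCycle {i} {j} eq = toℕ-injective (edge-injective (toℕ≤pred[n] i) (toℕ≤pred[n] j) eq)
    step     lineCycle i rewrite toℕ-inject₁ i = edge-adjacent (toℕ<n i)
    close    lineCycle rewrite toℕ-fromℕ (2 + l) = closing-adjacent

  decycling⇒acyclic : ∀ {S} → Decycles (LineGraph G) S → Acyclic (∁ S)
  decycling⇒acyclic decycles l c =
    decycles l (lineCycle c) (λ i → x∈∁p⇒x∉p (CycleIn.edge-∈ c (toℕ≤pred[n] i)))

  acyclic-⊆ : ∀ {E E'} → E' ⊆ E → Acyclic E → Acyclic E'
  acyclic-⊆ E'⊆E acyclic l c = acyclic l record { CycleIn c hiding (edge-∈) ; edge-∈ = E'⊆E ∘ CycleIn.edge-∈ c }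

  module _ {E : Subset m} where

    path-length<n : ∀ {T} → Path E T → T < n
    path-length<n {T} p with T <? n
    ... | yes T<n = T<n
    ... | no  T≮n with pigeonhole (s≤s (≮⇒≥ T≮n)) (Path.vertex p ∘ toℕ)
    ... | i , j , i<j , eq =
      ⊥-elim (<-irrefl (Path.vertex-injective p (toℕ≤pred[n] i) (toℕ≤pred[n] j) eq) i<j)

    edgePath : ∀ {e} → e ∈ E → Path E 1
    edgePath {e} e∈E = record
      { vertex           = src G e ∷ˢ λ _ → tgt G e
      ; edge             = λ _ → e
      ; vertex-injective = injective
      ; edge-joins       = λ { {zero} _ → inj₁ (refl , refl) ; {suc _} (s≤s ()) }
      ; edge-∈           = λ _ → e∈E
      }
      where
      injective : ∀ {i j} → i ≤ 1 → j ≤ 1 → (src G e ∷ˢ λ _ → tgt G e) i ≡ (src G e ∷ˢ λ _ → tgt G e) j → i ≡ j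
      injective {zero}  {zero}  _ _ _  = refl
      injective {zero}  {suc _} _ _ eq = ⊥-elim (loopless G e eq)
      injective {suc _} {zero}  _ _ eq = ⊥-elim (loopless G e (sym eq))
      injective {suc zero}    {suc zero} _ _ _ = refl
      injective {suc (suc _)} (s≤s ()) _ _
      injective {_} {suc (suc _)} _ (s≤s ()) _

    closePath : ∀ {T l g} (p : Path E T) → 2 + l ≤ T → g ∈ E →
              Joins g (Path.vertex p 0) (Path.vertex p (2 + l)) → CycleIn E l
    closePath {T} {l} {g} p K≤T g∈E g-joins = record
      { vertex           = vertex (2 + l) ∷ˢ vertex
      ; edge             = g ∷ˢ edge
      ; vertex-injective = injective
      ; closes           = refl
      ; edge-joins       = λ { {zero} _ → joins-sym g-joins ; {suc i} i<K → edge-joins (<-≤-trans i<K K≤T) }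
      ; edge-∈           = λ { {zero} _ → g∈E ; {suc i} i<K → edge-∈ (<-≤-trans i<K K≤T) }
      }
      where
      open Path p
      injective : ∀ {i j} → i ≤ 2 + l → j ≤ 2 + l → (vertex (2 + l) ∷ˢ vertex) i ≡ (vertex (2 + l) ∷ˢ vertex) j → i ≡ j
      injective {zero}  {zero}  _   _   _  = refl
      injective {zero}  {suc j} _   j<K eq = ⊥-elim (<⇒≢ j<K (sym (vertex-injective K≤T (≤-trans (<⇒≤ j<K) K≤T) eq)))
      injective {suc i} {zero}  i<K _   eq = ⊥-elim (<⇒≢ i<K (vertex-injective (≤-trans (<⇒≤ i<K) K≤T) K≤T eq))
      injective {suc i} {suc j} i<K j<K eq = cong suc (vertex-injective (≤-trans (<⇒≤ i<K) K≤T) (≤-trans (<⇒≤ j<K) K≤T) eq)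

    module _ (acyclic : Acyclic E) {T : ℕ} (p : Path E (suc T)) {g : Fin m} {u : Fin n}
             (g∈E : g ∈ E) (g≢e₀ : g ≢ Path.edge p 0) (g-joins : Joins g (Path.vertex p 0) u) where
      open Path p

      -- On the path, u would make g a loop, a second edge parallel to the
      -- first one, or the closing edge of a cycle.
      unvisited : ∀ {i} → i ≤ suc T → vertex i ≢ u
      unvisited {zero}        _   eq = joins-irrefl (subst (Joins g (vertex 0)) (sym eq) g-joins)
      unvisited {suc zero}    _   eq = g≢e₀ (joins-unique (subst (Joins g (vertex 0)) (sym eq) g-joins) (edge-joins z<s))
      unvisited {suc (suc l)} K≤T eq = acyclic l (closePath p K≤T g∈E (subst (Joins g (vertex 0)) (sym eq) g-joins))

      prepend : Path E (2 + T)
      prepend = record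
        { vertex           = u ∷ˢ vertex
        ; edge             = g ∷ˢ edge
        ; vertex-injective = injective
        ; edge-joins       = λ { {zero} _ → joins-sym g-joins ; {suc i} (s≤s i<T) → edge-joins i<T }
        ; edge-∈           = λ { {zero} _ → g∈E ; {suc i} (s≤s i<T) → edge-∈ i<T }
        }
        where
        injective : ∀ {i j} → i ≤ 2 + T → j ≤ 2 + T → (u ∷ˢ vertex) i ≡ (u ∷ˢ vertex) j → i ≡ j
        injective {zero}  {zero}  _         _         _  = refl
        injective {zero}  {suc j} _         (s≤s j≤)  eq = ⊥-elim (unvisited j≤ (sym eq))
        injective {suc i} {zero}  (s≤s i≤)  _         eq = ⊥-elim (unvisited i≤ eq)
        injective {suc i} {suc j} (s≤s i≤)  (s≤s j≤)  eq = cong suc (vertex-injective i≤ j≤ eq)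

  module _ {V : Subset n} {E : Subset m} (within : EdgesWithin V E) (acyclic : Acyclic E) where

    acyclic⇒∃leaf : Nonempty E → ∃ λ v → v ∈ V × ∣ E ∩ edgesAt v ∣ ≤ 1
    acyclic⇒∃leaf (e , e∈E) with any? (λ v → v ∈? V ×-dec ∣ E ∩ edgesAt v ∣ ≤? 1)
    ... | yes found = found
    ... | no  none  = ⊥-elim (1+n≰n (<⇒≤ (path-length<n (longPath n))))
      where
      degree≥2 : ∀ {v} → v ∈ V → 2 ≤ ∣ E ∩ edgesAt v ∣
      degree≥2 v∈V = ≰⇒> (λ degree≤1 → none (_ , v∈V , degree≤1))

      extend : ∀ {T} → Path E (suc T) → Path E (2 + T)
      extend p =
        let open Path p
            start∈V         = incident-within within (edge-∈ z<s) (joins⇒incident (edge-joins z<s))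
            g , g∈ , g≢e₀   = 2≤∣p∣⇒∃≢ (degree≥2 start∈V) (edge 0)
            g∈E , g∈edgesAt = x∈p∩q⁻ E (edgesAt (vertex 0)) g∈
        in prepend acyclic p g∈E g≢e₀ (proj₂ (incident⇒joins (∈edgesAt⁻ g∈edgesAt)))

      longPath : ∀ k → Path E (suc k)
      longPath zero    = edgePath e∈E
      longPath (suc k) = extend (longPath k)

  acyclic⇒∣E∣<∣V∣ : ∀ {V E} → Acc _⊂_ V → EdgesWithin V E → Acyclic E → Nonempty E → ∣ E ∣ < ∣ V ∣
  acyclic⇒∣E∣<∣V∣ {V} {E} (acc smaller) within acyclic (e , e∈E) with acyclic⇒∃leaf within acyclic (e , e∈E)
  ... | v , v∈V , degree≤1 with nonempty? (E ─ edgesAt v)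
  ... | yes nonempty = begin-strict
    ∣ E ∣                  ≤⟨ ∣p∩q∣≤1⇒∣p∣≤1+∣p─q∣ E (edgesAt v) degree≤1 ⟩
    suc ∣ E ─ edgesAt v ∣  <⟨ s≤s (acyclic⇒∣E∣<∣V∣ (smaller (x∈p⇒p-x⊂p v∈V)) within′ acyclic′ nonempty) ⟩
    suc ∣ V - v ∣          ≤⟨ x∈p⇒∣p-x∣<∣p∣ v∈V ⟩
    ∣ V ∣                  ∎
    where
    open ≤-Reasoning
    acyclic′ : Acyclic (E ─ edgesAt v)
    acyclic′ = acyclic-⊆ (p─q⊆p E (edgesAt v)) acyclic
    within′ : EdgesWithin (V - v) (E ─ edgesAt v)
    within′ e′∈ =
      let e∈E = p─q⊆p E (edgesAt v) e′∈
          avoids-v = x∈p─q⇒x∉q e′∈ ∘ ∈edgesAt⁺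
      in x∈p∧x≢y⇒x∈p-y (proj₁ (within e∈E)) (avoids-v ∘ inj₁) ,
         x∈p∧x≢y⇒x∈p-y (proj₂ (within e∈E)) (avoids-v ∘ inj₂)
  ... | no empty = begin-strict
    ∣ E ∣                 ≤⟨ ∣p∩q∣≤1⇒∣p∣≤1+∣p─q∣ E (edgesAt v) degree≤1 ⟩
    suc ∣ E ─ edgesAt v ∣ ≡⟨ cong suc (Empty⇒∣p∣≡0 empty) ⟩
    1                     <⟨ x∈p∧y∈p∧x≢y⇒2≤∣p∣ (proj₁ (within e∈E)) (proj₂ (within e∈E)) (loopless G e) ⟩
    ∣ V ∣                 ∎
    where open ≤-Reasoning

  acyclic⇒∣E∣<n : ∀ {E} → 0 < n → Acyclic E → ∣ E ∣ < n
  acyclic⇒∣E∣<n {E} 0<n acyclic with nonempty? E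
  ... | yes nonempty = subst (∣ E ∣ <_) (∣⊤∣≡n n) (acyclic⇒∣E∣<∣V∣ (⊂-wellFounded ⊤) (λ _ → ∈⊤ , ∈⊤) acyclic nonempty)
  ... | no  empty    = subst (_< n) (sym (Empty⇒∣p∣≡0 empty)) 0<n

mainTheorem9 : ∀ (n m : ℕ) → 1 ≤ n → (G : SimpleGraph n m) → (d : ℕ) →
                 IsDecyclingNumber (LineGraph G) d → m + 1 ≤ d + n
mainTheorem9 n m 0<n G _ ((S , decycles , refl) , _) = begin
  m + 1                      ≡⟨ +-comm m 1 ⟩
  suc m                      ≤⟨ s≤s (m≤n+m∸n m ∣ S ∣) ⟩
  suc (∣ S ∣ + (m ∸ ∣ S ∣))  ≡⟨ +-suc ∣ S ∣ (m ∸ ∣ S ∣) ⟨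
  ∣ S ∣ + suc (m ∸ ∣ S ∣)    ≤⟨ +-monoʳ-≤ ∣ S ∣ ∣∁S∣<n ⟩
  ∣ S ∣ + n                  ∎
  where
  open ≤-Reasoning
  ∣∁S∣<n : m ∸ ∣ S ∣ < n
  ∣∁S∣<n = subst (_< n) (∣∁p∣≡n∸∣p∣ S) (acyclic⇒∣E∣<n G 0<n (decycling⇒acyclic G decycles))
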